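{- Let $n\in\mathbb{P}$, $I,J\subseteq[n-1]$ with $I\cap J=\emptyset$, and let $i,k\in\mathbb{P}$ be such that $K:=[i,i+2k-1]$ is a connected component of $I\cup J$ with $K\subseteq J$. Then, for each choice of sign $\pm$, $$\sum_{\sigma\in\mathcal{D}^I_J(C_{n,\pm})}(-1)^{\ell(\sigma)}x^{L(\sigma)}=(-1)^k x^{k(k+1)}\sum_{\sigma\in\mathcal{D}^{I\cup K}_{J\setminus K}(C_{n,\pm})}(-1)^{\ell(\sigma)}x^{L(\sigma)}.$$ In particular, $$\sum_{\sigma\in\mathcal{D}^I_J(S_n)}(-1)^{\ell(\sigma)}x^{L(\sigma)}=(-1)^k x^{k(k+1)}\sum_{\sigma\in\mathcal{D}^{I\cup K}_{J\setminus K}(S_n)}(-1)^{\ell(\sigma)}x^{L(\sigma)}.$$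
   Context: $[a,b]=\{a,\ldots,b\}$. Connected components of a subset of $[n-1]$ are its maximal intervals of consecutive integers. $S_n$ is the symmetric group on $[n]$. For $\sigma\in S_n$: $\ell(\sigma)$ = number of pairs $i<j$ with $\sigma(i)>\sigma(j)$; $L(\sigma)$ = number of such pairs with $i\not\equiv j\pmod 2$; $D(\sigma)=\{i\in[n-1]:\sigma(i)>\sigma(i+1)\}$. For disjoint $I,J\subseteq[n-1]$ and $X\subseteq S_n$, $\mathcal{D}^I_J(X)=\{\sigma\in X: J\subseteq D(\sigma)\subseteq[n-1]\setminus I\}$. $C_{n,+}=\{w\in S_n: i+w(i)\text{ even } \forall i\}$, $C_{n,- }=\{w\in S_n: i+w(i)\text{ odd }\forall i\}$. -}

module Defs where

open import Data.Bool using (Bool; true; false; not; _∧_; _∨_; if_then_else_; _xor_)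
open import Data.Nat using (ℕ; zero; suc; _+_; _*_; _∸_; _≤_; _<_; _≡ᵇ_; _<ᵇ_)
open import Data.Fin using (Fin; toℕ)
open import Data.Vec using (Vec; []; _∷_; toList)
open import Data.List using (List; []; _∷_; [_]; map; concatMap; upTo; allFin; filterᵇ; foldr)
open import Data.Bool.ListAction using (all)
open import Data.Nat.ListAction using (sum)
open import Data.Product using (_×_; _,_)
open import Data.Sign using (Sign)
open import Data.Integer using (ℤ; -1ℤ; 0ℤ) renaming (_+_ to _+ℤ_; _*_ to _*ℤ_; _^_ to _^ℤ_)
open import Relation.Binary.PropositionalEquality using (_≡_)

-- the integer interval [a,b] = {a,...,b} as a list (empty if b < a)
range : ℕ → ℕ → List ℕ
range a b = map (a +_) (upTo (suc b ∸ a))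

even : ℕ → Bool
even zero = true
even (suc m) = not (even m)

allVecs : (n m : ℕ) → List (Vec (Fin n) m)
allVecs n zero = [ [] ]
allVecs n (suc m) = concatMap (λ f → map (f ∷_) (allVecs n m)) (allFin n)

-- A word σ : Vec (Fin n) n is read as the map [n] → [n], i ↦ σ(i),
-- with 1-based positions and values:  σ(i) = 1 + toℕ (i-th entry).
nth : ∀ {n} → List (Fin n) → ℕ → ℕ
nth [] _ = 0
nth (x ∷ xs) zero = suc (toℕ x)
nth (x ∷ xs) (suc m) = nth xs m

val : ∀ {n} → Vec (Fin n) n → ℕ → ℕ
val σ i = nth (toList σ) (i ∸ 1)

pairs : ℕ → List (ℕ × ℕ)
pairs n = concatMap (λ i → map (i ,_) (range (suc i) n)) (range 1 n)

-- σ is a permutation of [n] (injective, hence bijective)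
isPerm : ∀ {n} → Vec (Fin n) n → Bool
isPerm {n} σ = all (λ { (i , j) → not (val σ i ≡ᵇ val σ j) }) (pairs n)

Sym : (n : ℕ) → List (Vec (Fin n) n)
Sym n = filterᵇ isPerm (allVecs n n)

parityOK : ∀ {n} → Sign → Vec (Fin n) n → Bool
parityOK {n} Sign.+ σ = all (λ i → even (i + val σ i)) (range 1 n)
parityOK {n} Sign.- σ = all (λ i → not (even (i + val σ i))) (range 1 n)

C : (n : ℕ) → Sign → List (Vec (Fin n) n)
C n s = filterᵇ (parityOK s) (Sym n)

ℓ : ∀ {n} → Vec (Fin n) n → ℕ
ℓ {n} σ = sum (map (λ { (i , j) → if val σ j <ᵇ val σ i then 1 else 0 }) (pairs n))

L : ∀ {n} → Vec (Fin n) n → ℕ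
L {n} σ = sum (map (λ { (i , j) → if (val σ j <ᵇ val σ i) ∧ (even i xor even j) then 1 else 0 }) (pairs n))

desc : ∀ {n} → Vec (Fin n) n → ℕ → Bool
desc σ i = val σ (suc i) <ᵇ val σ i

Subset : Set
Subset = ℕ → Bool

_∪_ : Subset → Subset → Subset
(A ∪ B) m = A m ∨ B m

_∖_ : Subset → Subset → Subset
(A ∖ B) m = A m ∧ not (B m)

_⊆_ : Subset → Subset → Set
A ⊆ B = ∀ m → A m ≡ true → B m ≡ true

⊆[_-1] : ℕ → Subset → Set
⊆[ n -1] A = ∀ m → A m ≡ true → 1 ≤ m × m ≤ n ∸ 1

Disjoint : Subset → Subset → Set
Disjoint A B = ∀ m → A m ∧ B m ≡ false

interval : ℕ → ℕ → Subset
interval a b m = (a Data.Nat.≤ᵇ m) ∧ (m Data.Nat.≤ᵇ b)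

-- K is a connected component (maximal interval of consecutive integers) of A,
-- where K = [a,b] with 1 ≤ a ≤ b
IsComponent : ℕ → ℕ → Subset → Set
IsComponent a b A = (interval a b ⊆ A) × (A (a ∸ 1) ≡ false) × (A (suc b) ≡ false)

𝒟 : (n : ℕ) → (I J : Subset) → List (Vec (Fin n) n) → List (Vec (Fin n) n)
𝒟 n I J X = filterᵇ (λ σ → all (λ m → (not (J m) ∨ desc σ m) ∧ (not (I m) ∨ not (desc σ m))) (range 1 (n ∸ 1))) X

genSum : ∀ {n} → ℤ → List (Vec (Fin n) n) → ℤ
genSum x X = foldr (λ σ acc → ((-1ℤ ^ℤ ℓ σ) *ℤ (x ^ℤ L σ)) +ℤ acc) 0ℤ X

module Submission where

-- Put a = i and b = i + 2k, so that K = [a, b-1] and the positions touched by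
-- the descents in K form the block [a, b] of odd length 2k + 1.  Let ρ be the
-- reflection p ↦ a + b - p of [a, b] (the identity outside) and reverse-block
-- the involution σ ↦ σ ∘ ρ on words.  Since a + b is even, ρ preserves
-- parities, so reverse-block preserves S_n and C_{n,±}.  Because K is a
-- component of I ∪ J contained in J, an injective σ lies in 𝒟^I_J exactly when
-- σ ∘ ρ lies in 𝒟^{I∪K}_{J∖K}: descents away from the block are unchanged,
-- a - 1 and b lie in neither I nor J, and a descent of σ at m ∈ K is an ascent
-- of σ ∘ ρ at the mirror position a + b - 1 - m.  For such σ every pair of
-- block positions is an inversion of σ and none of σ ∘ ρ, while ρ preserves
-- the order of all other pairs; hence ℓ(σ) = ℓ(σ ∘ ρ) + k(2k+1) and
-- L(σ) = L(σ ∘ ρ) + k(k+1), the latter counting the block pairs of opposite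
-- parity.  As (-1)^{k(2k+1)} = (-1)^k, reindexing the sums along the
-- involution gives both identities.

open import Defs
open import Data.Bool using (Bool; true; false; not; _∧_; _∨_; if_then_else_; T; _xor_)
open import Data.Bool.Properties using (not-involutive; not-distribˡ-xor; ∧-zeroʳ; ∨-zeroʳ; ∧-identityʳ; ∨-identityʳ; xor-identityʳ)
open import Data.Bool.ListAction using (all)
open import Data.Nat using (ℕ; zero; suc; _+_; _*_; _∸_; _≤_; _<_; _≡ᵇ_; _<ᵇ_; _≤ᵇ_; z≤n; s≤s; _≤?_; _<?_; s≤s⁻¹)
open import Data.Nat.Properties
open import Data.Nat.ListAction using (sum)
open import Data.Nat.ListAction.Properties using (sum-++)
open import Data.Nat.Tactic.RingSolver using (solve-∀)
open import Data.Fin using (Fin; toℕ; fromℕ<)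
import Data.Fin as Fin
open import Data.Fin.Properties using (toℕ-injective; toℕ-fromℕ<; toℕ<n)
open import Data.Vec using (Vec; []; _∷_; toList; lookup; tabulate)
open import Data.Vec.Properties using (lookup∘tabulate; tabulate∘lookup; tabulate-cong; ∷-injective)
open import Data.List using (List; []; _∷_; [_]; map; concatMap; upTo; allFin; filterᵇ; foldr; _++_; cartesianProductWith)
open import Data.List.Properties using (map-++; map-∘; upTo-∷ʳ)
open import Data.List.Relation.Unary.All using ([])
open import Data.List.Relation.Unary.AllPairs using ([]; _∷_)
open import Data.List.Relation.Unary.Any using (Any; here; there)
open import Data.List.Relation.Unary.Unique.Propositional using (Unique)
import Data.List.Relation.Unary.Unique.Propositional.Properties as Unique
open import Data.List.Relation.Binary.Permutation.Propositional as Perm using (_↭_)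
open import Data.List.Relation.Binary.BagAndSetEquality using (∼bag⇒↭)
open import Data.List.Membership.Propositional.Properties.WithK using (unique∧set⇒bag)
open import Data.List.Membership.Propositional using (_∈_; find; lose)
open import Data.List.Membership.Propositional.Properties
  using (∈-map⁺; ∈-map⁻; ∈-allFin; ∈-upTo⁺; ∈-upTo⁻; ∈-concatMap⁺; ∈-concatMap⁻)
open import Data.Integer using (ℤ; -1ℤ; 0ℤ; 1ℤ) renaming (_+_ to _+ℤ_; _*_ to _*ℤ_; _^_ to _^ℤ_)
import Data.Integer.Properties as ℤ
import Data.Integer.Tactic.RingSolver as ℤ-Solver
open import Data.Product using (_×_; _,_; proj₁; proj₂; uncurry)
open import Data.Sum using (_⊎_; inj₁; inj₂)
open import Data.Empty using (⊥; ⊥-elim)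
open import Data.Unit using (⊤; tt)
open import Data.Sign using (Sign)
open import Relation.Binary using (tri<; tri≈; tri>)
open import Relation.Binary.PropositionalEquality hiding ([_])
open import Relation.Nullary using (¬_; yes; no)
open import Relation.Nullary.Decidable using (dec-true; dec-false)
open import Function.Bundles using (mk⇔)

≤ᵇ-true : ∀ {m n} → m ≤ n → (m ≤ᵇ n) ≡ true
≤ᵇ-true {m} {n} = dec-true (m ≤? n)

≤ᵇ-false : ∀ {m n} → ¬ m ≤ n → (m ≤ᵇ n) ≡ false
≤ᵇ-false {m} {n} = dec-false (m ≤? n)

<ᵇ-true : ∀ {m n} → m < n → (m <ᵇ n) ≡ true
<ᵇ-true {m} {n} = dec-true (m <? n)

<ᵇ-false : ∀ {m n} → ¬ m < n → (m <ᵇ n) ≡ false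
<ᵇ-false {m} {n} = dec-false (m <? n)

≡true⇒T : ∀ {b} → b ≡ true → T b
≡true⇒T refl = tt

ind : Bool → ℕ
ind b = if b then 1 else 0

sumTo : ℕ → (ℕ → ℕ) → ℕ
sumTo zero    H = 0
sumTo (suc n) H = sumTo n H + H (suc n)

sumTo-cong : ∀ n {F G : ℕ → ℕ} → (∀ q → 1 ≤ q → q ≤ n → F q ≡ G q) → sumTo n F ≡ sumTo n G
sumTo-cong zero    e = refl
sumTo-cong (suc n) e =
  cong₂ _+_ (sumTo-cong n (λ q h1 h2 → e q h1 (m≤n⇒m≤1+n h2))) (e (suc n) (s≤s z≤n) ≤-refl)

sumTo-zero : ∀ n {F : ℕ → ℕ} → (∀ q → 1 ≤ q → q ≤ n → F q ≡ 0) → sumTo n F ≡ 0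
sumTo-zero zero    e = refl
sumTo-zero (suc n) e =
  cong₂ _+_ (sumTo-zero n (λ q h1 h2 → e q h1 (m≤n⇒m≤1+n h2))) (e (suc n) (s≤s z≤n) ≤-refl)

sumTo-+ : ∀ n (F G : ℕ → ℕ) → sumTo n (λ q → F q + G q) ≡ sumTo n F + sumTo n G
sumTo-+ zero    F G = refl
sumTo-+ (suc n) F G rewrite sumTo-+ n F G = exchange (sumTo n F) (sumTo n G) (F (suc n)) (G (suc n))
  where
  exchange : ∀ w x y z → (w + x) + (y + z) ≡ (w + y) + (x + z)
  exchange = solve-∀

sumTo-const : ∀ n → sumTo n (λ _ → 1) ≡ n
sumTo-const zero    = refl
sumTo-const (suc n) = trans (cong (_+ 1) (sumTo-const n)) (+-comm n 1)

sumTo-split : ∀ x y (H : ℕ → ℕ) → sumTo (x + y) H ≡ sumTo x H + sumTo y (λ t → H (x + t))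
sumTo-split x zero    H rewrite +-identityʳ x = sym (+-identityʳ (sumTo x H))
sumTo-split x (suc y) H rewrite +-suc x y | sumTo-split x y H = +-assoc (sumTo x H) _ _

sumTo-reverse : ∀ m (G : ℕ → ℕ) → sumTo m (λ t → G (suc m ∸ t)) ≡ sumTo m G
sumTo-reverse zero    G = refl
sumTo-reverse (suc m) G = begin
    sumTo m (λ t → G (suc (suc m) ∸ t)) + G (suc m ∸ m)
      ≡⟨ cong₂ _+_ (sumTo-cong m (λ t _ h → cong G (+-∸-assoc 1 (m≤n⇒m≤1+n h))))
                   (cong G (trans (+-∸-assoc 1 {m} ≤-refl) (cong suc (n∸n≡0 m)))) ⟩
    sumTo m (λ t → G (suc (suc m ∸ t))) + G 1
      ≡⟨ cong (_+ G 1) (sumTo-reverse m (λ t → G (suc t))) ⟩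
    sumTo m (λ t → G (suc t)) + G 1
      ≡⟨ trans (+-comm _ (G 1)) (sym (first-term m)) ⟩
    sumTo (suc m) G ∎
  where
  open ≡-Reasoning
  first-term : ∀ m → sumTo (suc m) G ≡ G 1 + sumTo m (λ t → G (suc t))
  first-term zero    = +-comm 0 (G 1)
  first-term (suc m) rewrite first-term m = +-assoc (G 1) (sumTo m (λ t → G (suc t))) (G (suc (suc m)))

pairSum : ℕ → (ℕ → ℕ → ℕ) → ℕ
pairSum n X = sumTo n (λ p → sumTo n (λ q → if p <ᵇ q then X p q else 0))

pairSum-cong : ∀ n {X Y : ℕ → ℕ → ℕ} → (∀ p q → 1 ≤ p → p < q → q ≤ n → X p q ≡ Y p q) →
  pairSum n X ≡ pairSum n Y
pairSum-cong n {X} {Y} e = sumTo-cong n (λ p h1 _ → sumTo-cong n (λ q _ h2 → term p q h1 h2))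
  where
  term : ∀ p q → 1 ≤ p → q ≤ n → (if p <ᵇ q then X p q else 0) ≡ (if p <ᵇ q then Y p q else 0)
  term p q h1 h2 with p <ᵇ q in lt
  ... | true  = e p q h1 (<ᵇ⇒< p q (≡true⇒T lt)) h2
  ... | false = refl

pairSum-suc : ∀ m X → pairSum (suc m) X ≡ pairSum m X + sumTo m (λ u → X u (suc m))
pairSum-suc m X = begin
    sumTo m (λ u → sumTo m (λ v → if u <ᵇ v then X u v else 0) + (if u <ᵇ suc m then X u (suc m) else 0))
      + sumTo (suc m) (λ v → if suc m <ᵇ v then X (suc m) v else 0)
      ≡⟨ cong₂ _+_ (sumTo-cong m (λ u _ h → cong (λ d → sumTo m (λ v → if u <ᵇ v then X u v else 0)
                                                            + (if d then X u (suc m) else 0)) (<ᵇ-true (s≤s h))))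
                   (sumTo-zero (suc m) (λ v _ h → cong (if_then X (suc m) v else 0) (<ᵇ-false (≤⇒≯ h)))) ⟩
    sumTo m (λ u → sumTo m (λ v → if u <ᵇ v then X u v else 0) + X u (suc m)) + 0
      ≡⟨ trans (+-identityʳ _) (sumTo-+ m _ _) ⟩
    pairSum m X + sumTo m (λ u → X u (suc m)) ∎
  where open ≡-Reasoning

sum-range : ∀ a n (F : ℕ → ℕ) → 1 ≤ a → sum (map F (range a n)) ≡ sumTo n (λ q → if a ≤ᵇ q then F q else 0)
sum-range a zero    F (s≤s z≤n) rewrite 0∸n≡0 (a ∸ 1) = refl
sum-range a (suc n) F 1≤a with a ≤? suc n
... | yes a≤ = begin
    sum (map F (map (a +_) (upTo (suc (suc n) ∸ a))))
      ≡⟨ cong (λ z → sum (map F (map (a +_) z))) (trans (cong upTo (+-∸-assoc 1 a≤)) (sym (upTo-∷ʳ (suc n ∸ a)))) ⟩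
    sum (map F (map (a +_) (upTo (suc n ∸ a) ++ [ suc n ∸ a ])))
      ≡⟨ cong (λ z → sum (map F z)) (map-++ (a +_) (upTo (suc n ∸ a)) _) ⟩
    sum (map F (range a n ++ [ a + (suc n ∸ a) ]))
      ≡⟨ trans (cong sum (map-++ F (range a n) _)) (sum-++ (map F (range a n)) _) ⟩
    sum (map F (range a n)) + (F (a + (suc n ∸ a)) + 0)
      ≡⟨ cong₂ _+_ (sum-range a n F 1≤a) (trans (+-identityʳ _) (cong F (m+[n∸m]≡n a≤))) ⟩
    sumTo n (λ q → if a ≤ᵇ q then F q else 0) + F (suc n)
      ≡⟨ cong (λ d → sumTo n (λ q → if a ≤ᵇ q then F q else 0) + (if d then F (suc n) else 0)) (sym (≤ᵇ-true a≤)) ⟩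
    sumTo (suc n) (λ q → if a ≤ᵇ q then F q else 0) ∎
  where open ≡-Reasoning
... | no a≰ = trans (cong (λ z → sum (map F (map (a +_) (upTo z)))) (m≤n⇒m∸n≡0 (≰⇒> a≰)))
    (sym (sumTo-zero (suc n) (λ q _ h → cong (if_then F q else 0) (≤ᵇ-false (<⇒≱ (<-≤-trans (s≤s h) (≰⇒> a≰)))))))

sum-concatMap : ∀ {A B : Set} (h : B → ℕ) (G : A → List B) (xs : List A) →
  sum (map h (concatMap G xs)) ≡ sum (map (λ p → sum (map h (G p))) xs)
sum-concatMap h G []       = refl
sum-concatMap h G (x ∷ xs) = begin
    sum (map h (G x ++ concatMap G xs))                ≡⟨ cong sum (map-++ h (G x) _) ⟩
    sum (map h (G x) ++ map h (concatMap G xs))        ≡⟨ sum-++ (map h (G x)) _ ⟩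
    sum (map h (G x)) + sum (map h (concatMap G xs))   ≡⟨ cong (sum (map h (G x)) +_) (sum-concatMap h G xs) ⟩
    sum (map h (G x)) + sum (map (λ p → sum (map h (G p))) xs) ∎
  where open ≡-Reasoning

sum-pairs : ∀ n (h : ℕ × ℕ → ℕ) → sum (map h (pairs n)) ≡ pairSum n (λ p q → h (p , q))
sum-pairs n h = begin
    sum (map h (pairs n))
      ≡⟨ sum-concatMap h (λ p → map (p ,_) (range (suc p) n)) (range 1 n) ⟩
    sum (map (λ p → sum (map h (map (p ,_) (range (suc p) n)))) (range 1 n))
      ≡⟨ sum-range 1 n _ (s≤s z≤n) ⟩
    sumTo n (λ p → if 1 ≤ᵇ p then sum (map h (map (p ,_) (range (suc p) n))) else 0)
      ≡⟨ sumTo-cong n (λ { (suc p) _ _ → trans (cong sum (sym (map-∘ (range (suc (suc p)) n))))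
                                               (sum-range (suc (suc p)) n _ (s≤s z≤n)) }) ⟩
    pairSum n (λ p q → h (p , q)) ∎
  where open ≡-Reasoning

range-∈⁻ : ∀ {a b m} → m ∈ range a b → a ≤ m × m ≤ b
range-∈⁻ {a} {b} mem with ∈-map⁻ (a +_) mem
... | x , x∈ , refl = m≤m+n a x , bound (∈-upTo⁻ x∈)
  where
  bound : x < suc b ∸ a → a + x ≤ b
  bound lt with a ≤? suc b
  ... | yes a≤ = s≤s⁻¹ (subst (suc (a + x) ≤_) (m+[n∸m]≡n a≤) (subst (_≤ a + (suc b ∸ a)) (+-suc a x) (+-monoʳ-≤ a lt)))
  ... | no a≰  = ⊥-elim (n≮0 (subst (x <_) (m≤n⇒m∸n≡0 (<⇒≤ (≰⇒> a≰))) lt))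

range-∈⁺ : ∀ {a b m} → a ≤ m → m ≤ b → m ∈ range a b
range-∈⁺ {a} {b} a≤m m≤b = subst (_∈ range a b) (m+[n∸m]≡n a≤m) (∈-map⁺ (a +_) (∈-upTo⁺ (∸-monoˡ-< (s≤s m≤b) a≤m)))

pairs-∈⁻ : ∀ {n p q} → (p , q) ∈ pairs n → 1 ≤ p × p < q × q ≤ n
pairs-∈⁻ {n} mem with find (∈-concatMap⁻ (λ i → map (i ,_) (range (suc i) n)) {xs = range 1 n} mem)
... | i , i∈ , pq∈ with ∈-map⁻ (i ,_) pq∈
... | q , q∈ , refl = proj₁ (range-∈⁻ i∈) , range-∈⁻ q∈

pairs-∈⁺ : ∀ {n p q} → 1 ≤ p → p < q → q ≤ n → (p , q) ∈ pairs n
pairs-∈⁺ {n} {p} h1 h2 h3 = ∈-concatMap⁺ (λ i → map (i ,_) (range (suc i) n))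
  (lose (range-∈⁺ h1 (≤-trans (<⇒≤ h2) h3)) (∈-map⁺ (p ,_) (range-∈⁺ h2 h3)))

all-∈ : ∀ {A : Set} (p : A → Bool) {xs : List A} {x : A} → all p xs ≡ true → x ∈ xs → p x ≡ true
all-∈ p {y ∷ xs} e (here refl) with p y | e
... | true | _  = refl
all-∈ p {y ∷ xs} e (there m) with p y | e
... | true | e' = all-∈ p e' m

all-intro : ∀ {A : Set} (p : A → Bool) (xs : List A) → (∀ x → x ∈ xs → p x ≡ true) → all p xs ≡ true
all-intro p []       f = refl
all-intro p (x ∷ xs) f rewrite f x (here refl) = all-intro p xs (λ y m → f y (there m))

sumℤ : ∀ {A : Set} → List A → (A → ℤ) → ℤ
sumℤ xs f = foldr (λ σ acc → f σ +ℤ acc) 0ℤ xs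

sumℤ-filter : ∀ {A : Set} (p : A → Bool) (xs : List A) (f : A → ℤ) →
  sumℤ (filterᵇ p xs) f ≡ sumℤ xs (λ σ → if p σ then f σ else 0ℤ)
sumℤ-filter p []       f = refl
sumℤ-filter p (x ∷ xs) f with p x
... | true  = cong (f x +ℤ_) (sumℤ-filter p xs f)
... | false = trans (sumℤ-filter p xs f) (sym (ℤ.+-identityˡ _))

sumℤ-cong : ∀ {A : Set} (xs : List A) {f g : A → ℤ} → (∀ σ → f σ ≡ g σ) → sumℤ xs f ≡ sumℤ xs g
sumℤ-cong []       e = refl
sumℤ-cong (x ∷ xs) e = cong₂ _+ℤ_ (e x) (sumℤ-cong xs e)

sumℤ-scale : ∀ {A : Set} (xs : List A) (c : ℤ) (f : A → ℤ) → sumℤ xs (λ σ → c *ℤ f σ) ≡ c *ℤ sumℤ xs f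
sumℤ-scale []       c f = sym (ℤ.*-zeroʳ c)
sumℤ-scale (x ∷ xs) c f = trans (cong (c *ℤ f x +ℤ_) (sumℤ-scale xs c f)) (sym (ℤ.*-distribˡ-+ c (f x) (sumℤ xs f)))

sumℤ-map : ∀ {A : Set} (r : A → A) (xs : List A) (f : A → ℤ) → sumℤ (map r xs) f ≡ sumℤ xs (λ σ → f (r σ))
sumℤ-map r []       f = refl
sumℤ-map r (x ∷ xs) f = cong (f (r x) +ℤ_) (sumℤ-map r xs f)

sumℤ-↭ : ∀ {A : Set} {xs ys : List A} (f : A → ℤ) → xs ↭ ys → sumℤ xs f ≡ sumℤ ys f
sumℤ-↭ f Perm.refl        = refl
sumℤ-↭ f (Perm.prep x p)  = cong (f x +ℤ_) (sumℤ-↭ f p)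
sumℤ-↭ {xs = _ ∷ _ ∷ xs} {ys = _ ∷ _ ∷ ys} f (Perm.swap x y p) = begin
    f x +ℤ (f y +ℤ sumℤ xs f)  ≡⟨ sym (ℤ.+-assoc (f x) (f y) _) ⟩
    (f x +ℤ f y) +ℤ sumℤ xs f  ≡⟨ cong₂ _+ℤ_ (ℤ.+-comm (f x) (f y)) (sumℤ-↭ f p) ⟩
    (f y +ℤ f x) +ℤ sumℤ ys f  ≡⟨ ℤ.+-assoc (f y) (f x) _ ⟩
    f y +ℤ (f x +ℤ sumℤ ys f)  ∎
  where open ≡-Reasoning
sumℤ-↭ f (Perm.trans p q) = trans (sumℤ-↭ f p) (sumℤ-↭ f q)

allVecs-complete : ∀ n m (v : Vec (Fin n) m) → v ∈ allVecs n m
allVecs-complete n zero    []      = here refl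
allVecs-complete n (suc m) (a ∷ v) = ∈-concatMap⁺ (λ f → map (f ∷_) (allVecs n m))
  (lose (∈-allFin a) (∈-map⁺ (a ∷_) (allVecs-complete n m v)))

allVecs-unique : ∀ n m → Unique (allVecs n m)
allVecs-unique n zero    = [] ∷ []
allVecs-unique n (suc m) = subst Unique (sym (as-product (allFin n)))
    (Unique.cartesianProductWith⁺ _∷_ ∷-injective (Unique.allFin⁺ n) (allVecs-unique n m))
  where
  as-product : ∀ xs → concatMap (λ f → map (f ∷_) (allVecs n m)) xs ≡ cartesianProductWith _∷_ xs (allVecs n m)
  as-product []       = refl
  as-product (x ∷ xs) = cong (map (x ∷_) (allVecs n m) ++_) (as-product xs)

allVecs-involution : ∀ n m (r : Vec (Fin n) m → Vec (Fin n) m) → (∀ v → r (r v) ≡ v) →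
  map r (allVecs n m) ↭ allVecs n m
allVecs-involution n m r inv = ∼bag⇒↭ (unique∧set⇒bag
    (Unique.map⁺ (λ {x} {y} e → trans (sym (inv x)) (trans (cong r e) (inv y))) (allVecs-unique n m))
    (allVecs-unique n m)
    (λ {z} → mk⇔ (λ _ → allVecs-complete n m z)
         (λ _ → subst (_∈ map r (allVecs n m)) (inv z) (∈-map⁺ r (allVecs-complete n m (r z))))))

sum-involution : ∀ n m (r : Vec (Fin n) m → Vec (Fin n) m) → (∀ v → r (r v) ≡ v) →
  (c : ℤ) (f g : Vec (Fin n) m → ℤ) → (∀ v → f v ≡ c *ℤ g (r v)) →
  sumℤ (allVecs n m) f ≡ c *ℤ sumℤ (allVecs n m) g
sum-involution n m r inv c f g e = begin
    sumℤ (allVecs n m) f                       ≡⟨ sumℤ-cong (allVecs n m) e ⟩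
    sumℤ (allVecs n m) (λ v → c *ℤ g (r v))    ≡⟨ sumℤ-scale (allVecs n m) c _ ⟩
    c *ℤ sumℤ (allVecs n m) (λ v → g (r v))    ≡⟨ cong (c *ℤ_) (sym (sumℤ-map r (allVecs n m) g)) ⟩
    c *ℤ sumℤ (map r (allVecs n m)) g          ≡⟨ cong (c *ℤ_) (sumℤ-↭ g (allVecs-involution n m r inv)) ⟩
    c *ℤ sumℤ (allVecs n m) g                  ∎
  where open ≡-Reasoning

even-+ : ∀ x y → even (x + y) ≡ not (even x xor even y)
even-+ zero    y = sym (not-involutive (even y))
even-+ (suc x) y = trans (cong not (even-+ x y)) (cong not (not-distribˡ-xor (even x) (even y)))

even-double : ∀ m → even (m + m) ≡ true
even-double zero    = refl
even-double (suc m) rewrite +-suc m m | even-double m = refl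

xor-false⇒≡ : ∀ u v → not (u xor v) ≡ true → u ≡ v
xor-false⇒≡ true  true  _ = refl
xor-false⇒≡ false false _ = refl

data Position (a b p : ℕ) : Set where
  before : p < a → Position a b p
  inside : a ≤ p → p ≤ b → Position a b p
  after  : b < p → Position a b p

position : ∀ a b p → Position a b p
position a b p with p <? a | b <? p
... | yes h | _     = before h
... | no _  | yes h = after h
... | no h  | no h' = inside (≮⇒≥ h) (≮⇒≥ h')

module Reflection (a b : ℕ) where

  ρ : ℕ → ℕ
  ρ p = if (a ≤ᵇ p) ∧ (p ≤ᵇ b) then a + b ∸ p else p

  ρ-inside : ∀ {p} → a ≤ p → p ≤ b → ρ p ≡ a + b ∸ p
  ρ-inside h1 h2 rewrite ≤ᵇ-true h1 | ≤ᵇ-true h2 = refl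

  ρ-before : ∀ {p} → p < a → ρ p ≡ p
  ρ-before h rewrite ≤ᵇ-false (<⇒≱ h) = refl

  ρ-after : ∀ {p} → b < p → ρ p ≡ p
  ρ-after {p} h rewrite ≤ᵇ-false (<⇒≱ h) | ∧-zeroʳ (a ≤ᵇ p) = refl

  reflect-≥ : ∀ {p} → p ≤ b → a ≤ a + b ∸ p
  reflect-≥ h rewrite +-∸-assoc a h = m≤m+n a _

  reflect-≤ : ∀ {p} → a ≤ p → a + b ∸ p ≤ b
  reflect-≤ {p} h = subst (a + b ∸ p ≤_) (m+n∸m≡n a b) (∸-monoʳ-≤ (a + b) h)

  ρ-inside-bounds : ∀ {p} → a ≤ p → p ≤ b → a ≤ ρ p × ρ p ≤ b
  ρ-inside-bounds h1 h2 rewrite ρ-inside h1 h2 = reflect-≥ h2 , reflect-≤ h1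

  ρ-involutive : ∀ p → ρ (ρ p) ≡ p
  ρ-involutive p with position a b p
  ... | before h   rewrite ρ-before h = ρ-before h
  ... | after h    rewrite ρ-after h  = ρ-after h
  ... | inside h1 h2 rewrite ρ-inside h1 h2 | ρ-inside (reflect-≥ h2) (reflect-≤ h1) =
    m∸[m∸n]≡n (≤-trans h2 (m≤n+m b a))

  ρ-injective : ∀ {p q} → ρ p ≡ ρ q → p ≡ q
  ρ-injective {p} {q} e = trans (sym (ρ-involutive p)) (trans (cong ρ e) (ρ-involutive q))

  ρ-bounds : ∀ {n p} → 1 ≤ a → b ≤ n → 1 ≤ p → p ≤ n → 1 ≤ ρ p × ρ p ≤ n
  ρ-bounds {n} {p} ha hb h1 h2 with position a b p
  ... | before h     rewrite ρ-before h = h1 , h2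
  ... | after h      rewrite ρ-after h  = h1 , h2
  ... | inside m1 m2 rewrite ρ-inside m1 m2 = ≤-trans ha (reflect-≥ m2) , ≤-trans (reflect-≤ m1) hb

  ρ-even : even (a + b) ≡ true → ∀ p → even (ρ p) ≡ even p
  ρ-even ev p with position a b p
  ... | before h     rewrite ρ-before h = refl
  ... | after h      rewrite ρ-after h  = refl
  ... | inside m1 m2 rewrite ρ-inside m1 m2 = xor-false⇒≡ _ _
    (trans (sym (even-+ (a + b ∸ p) p)) (trans (cong even (m∸n+n≡m (≤-trans m2 (m≤n+m b a)))) ev))

  ρ-reverses : ∀ {p q} → a ≤ p → q ≤ b → p < q → ρ q < ρ p
  ρ-reverses {p} {q} h1 h2 lt rewrite ρ-inside h1 (≤-trans (<⇒≤ lt) h2) | ρ-inside (≤-trans h1 (<⇒≤ lt)) h2 =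
    ∸-monoʳ-< lt (≤-trans h2 (m≤n+m b a))

  NotBothInside : ∀ {p q} → Position a b p → Position a b q → Set
  NotBothInside (inside _ _) (inside _ _) = ⊥
  NotBothInside _            _            = ⊤

  ρ-preserves : ∀ {p q} (pp : Position a b p) (pq : Position a b q) → NotBothInside pp pq → (ρ p <ᵇ ρ q) ≡ (p <ᵇ q)
  ρ-preserves (before h) (before h') _ rewrite ρ-before h | ρ-before h' = refl
  ρ-preserves (before h) (after h')  _ rewrite ρ-before h | ρ-after h'  = refl
  ρ-preserves (after h)  (before h') _ rewrite ρ-after h  | ρ-before h' = refl
  ρ-preserves (after h)  (after h')  _ rewrite ρ-after h  | ρ-after h'  = refl
  ρ-preserves (before h) (inside m1 m2) _ rewrite ρ-before h | ρ-inside m1 m2 =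
    trans (<ᵇ-true (<-≤-trans h (reflect-≥ m2))) (sym (<ᵇ-true (<-≤-trans h m1)))
  ρ-preserves (inside m1 m2) (before h) _ rewrite ρ-before h | ρ-inside m1 m2 =
    trans (<ᵇ-false (≤⇒≯ (≤-trans (<⇒≤ h) (reflect-≥ m2)))) (sym (<ᵇ-false (≤⇒≯ (≤-trans (<⇒≤ h) m1))))
  ρ-preserves (inside m1 m2) (after h) _ rewrite ρ-after h | ρ-inside m1 m2 =
    trans (<ᵇ-true (≤-<-trans (reflect-≤ m1) h)) (sym (<ᵇ-true (≤-<-trans m2 h)))
  ρ-preserves (after h) (inside m1 m2) _ rewrite ρ-after h | ρ-inside m1 m2 =
    trans (<ᵇ-false (≤⇒≯ (≤-trans (reflect-≤ m1) (<⇒≤ h)))) (sym (<ᵇ-false (≤⇒≯ (≤-trans m2 (<⇒≤ h)))))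

nth-lookup : ∀ {n m} (σ : Vec (Fin n) m) (j : Fin m) → nth (toList σ) (toℕ j) ≡ suc (toℕ (lookup σ j))
nth-lookup (x ∷ σ) Fin.zero    = refl
nth-lookup (x ∷ σ) (Fin.suc j) = nth-lookup σ j

suc∸1 : ∀ {x} → 1 ≤ x → suc (x ∸ 1) ≡ x
suc∸1 (s≤s z≤n) = refl

module WordReversal (n a b : ℕ) (ha : 1 ≤ a) (hb : b ≤ n) where
  open Reflection a b

  ρ-fin-bound : (j : Fin n) → ρ (suc (toℕ j)) ∸ 1 < n
  ρ-fin-bound j with ρ-bounds {n} {suc (toℕ j)} ha hb (s≤s z≤n) (toℕ<n j)
  ... | h1 , h2 = subst (_≤ n) (sym (suc∸1 h1)) h2

  ρ-fin : Fin n → Fin n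
  ρ-fin j = fromℕ< (ρ-fin-bound j)

  suc-ρ-fin : ∀ j → suc (toℕ (ρ-fin j)) ≡ ρ (suc (toℕ j))
  suc-ρ-fin j = trans (cong suc (toℕ-fromℕ< (ρ-fin-bound j)))
    (suc∸1 (proj₁ (ρ-bounds {n} {suc (toℕ j)} ha hb (s≤s z≤n) (toℕ<n j))))

  ρ-fin-involutive : ∀ j → ρ-fin (ρ-fin j) ≡ j
  ρ-fin-involutive j = toℕ-injective (suc-injective
    (trans (suc-ρ-fin (ρ-fin j)) (trans (cong ρ (suc-ρ-fin j)) (ρ-involutive (suc (toℕ j))))))

  reverse-block : Vec (Fin n) n → Vec (Fin n) n
  reverse-block σ = tabulate (λ j → lookup σ (ρ-fin j))

  reverse-block-involutive : ∀ σ → reverse-block (reverse-block σ) ≡ σ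
  reverse-block-involutive σ = trans
    (tabulate-cong (λ j → trans (lookup∘tabulate _ (ρ-fin j)) (cong (lookup σ) (ρ-fin-involutive j))))
    (tabulate∘lookup σ)

  val-reverse-block : ∀ σ p → 1 ≤ p → p ≤ n → val (reverse-block σ) p ≡ val σ (ρ p)
  val-reverse-block σ (suc t) _ h = begin
      nth (toList (reverse-block σ)) t         ≡⟨ cong (nth (toList (reverse-block σ))) (sym (toℕ-fromℕ< h)) ⟩
      nth (toList (reverse-block σ)) (toℕ j)   ≡⟨ nth-lookup (reverse-block σ) j ⟩
      suc (toℕ (lookup (reverse-block σ) j))   ≡⟨ cong (λ z → suc (toℕ z)) (lookup∘tabulate _ j) ⟩
      suc (toℕ (lookup σ (ρ-fin j)))           ≡⟨ sym (nth-lookup σ (ρ-fin j)) ⟩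
      val σ (suc (toℕ (ρ-fin j)))              ≡⟨ cong (val σ) (suc-ρ-fin j) ⟩
      val σ (ρ (suc (toℕ j)))                  ≡⟨ cong (λ z → val σ (ρ (suc z))) (toℕ-fromℕ< h) ⟩
      val σ (ρ (suc t))                        ∎
    where
    open ≡-Reasoning
    j : Fin n
    j = fromℕ< h

sumTo-split-at : ∀ {c n} → c ≤ n → (H : ℕ → ℕ) → sumTo n H ≡ sumTo c H + sumTo (n ∸ c) (λ t → H (c + t))
sumTo-split-at {c} {n} c≤n H = trans (cong (λ z → sumTo z H) (sym (m+[n∸m]≡n c≤n))) (sumTo-split c (n ∸ c) H)

invSum : ℕ → (ℕ → ℕ) → (ℕ → ℕ → ℕ) → ℕ
invSum n f W = pairSum n (λ p q → ind (f q <ᵇ f p) * W p q)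

oppositeParity : ℕ → ℕ → ℕ
oppositeParity p q = ind (even p xor even q)

ℓ-invSum : ∀ {n} (σ : Vec (Fin n) n) → ℓ σ ≡ invSum n (val σ) (λ _ _ → 1)
ℓ-invSum {n} σ = trans (sum-pairs n _) (pairSum-cong n (λ p q _ _ _ → sym (*-identityʳ _)))

L-invSum : ∀ {n} (σ : Vec (Fin n) n) → L σ ≡ invSum n (val σ) oppositeParity
L-invSum {n} σ = trans (sum-pairs n _) (pairSum-cong n (λ p q _ _ _ → ind-∧ (val σ q <ᵇ val σ p) _))
  where
  ind-∧ : ∀ x y → ind (x ∧ y) ≡ ind x * ind y
  ind-∧ true  y = sym (+-identityʳ (ind y))
  ind-∧ false y = refl

-- Sums over [1, n] against the block [a, b] ⊆ [1, n]; c = a - 1 and m = b - c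
-- is the length of the block, whose positions are c + t for 1 ≤ t ≤ m.
module BlockSums (n a b : ℕ) (ha : 1 ≤ a) (a≤b : a ≤ b) (hb : b ≤ n) where
  open Reflection a b

  c m : ℕ
  c = a ∸ 1
  m = b ∸ c

  private
    suc-c : suc c ≡ a
    suc-c = suc∸1 ha

    c≤b : c ≤ b
    c≤b = ≤-trans (n≤1+n c) (subst (_≤ b) (sym suc-c) a≤b)

    c+m : c + m ≡ b
    c+m = m+[n∸m]≡n c≤b

  inBlock : ℕ → Bool
  inBlock p = (a ≤ᵇ p) ∧ (p ≤ᵇ b)

  inBlock-inside : ∀ {p} → a ≤ p → p ≤ b → inBlock p ≡ true
  inBlock-inside h1 h2 rewrite ≤ᵇ-true h1 | ≤ᵇ-true h2 = refl

  inBlock-before : ∀ {p} → p < a → inBlock p ≡ false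
  inBlock-before {p} h = cong (_∧ (p ≤ᵇ b)) (≤ᵇ-false (<⇒≱ h))

  inBlock-after : ∀ {p} → b < p → inBlock p ≡ false
  inBlock-after {p} h = trans (cong ((a ≤ᵇ p) ∧_) (≤ᵇ-false (<⇒≱ h))) (∧-zeroʳ _)

  before-block : ∀ {t} → t ≤ c → t < a
  before-block h = subst (_ <_) suc-c (s≤s h)

  after-block : ∀ {t} → 1 ≤ t → b < b + t
  after-block {t} h = m<m+n b h

  inside-block : ∀ {t} → 1 ≤ t → t ≤ m → a ≤ c + t × c + t ≤ b
  inside-block {suc t} _ h = subst (_≤ c + suc t) suc-c (subst (suc c ≤_) (sym (+-suc c t)) (s≤s (m≤m+n c t)))
                           , subst (c + suc t ≤_) c+m (+-monoʳ-≤ c h)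

  ρ-on-block : ∀ {t} → 1 ≤ t → t ≤ m → ρ (c + t) ≡ c + (suc m ∸ t)
  ρ-on-block {t} h1 h2 = begin
      ρ (c + t)                        ≡⟨ uncurry ρ-inside (inside-block h1 h2) ⟩
      a + b ∸ (c + t)                  ≡⟨ cong₂ (λ x y → x + y ∸ (c + t)) (sym suc-c) (sym c+m) ⟩
      suc c + (c + m) ∸ (c + t)        ≡⟨ cong (_∸ (c + t)) (regroup c m) ⟩
      c + (c + suc m) ∸ (c + t)        ≡⟨ [m+n]∸[m+o]≡n∸o c (c + suc m) t ⟩
      c + suc m ∸ t                    ≡⟨ +-∸-assoc c (m≤n⇒m≤1+n h2) ⟩
      c + (suc m ∸ t)                  ∎
    where
    open ≡-Reasoning
    regroup : ∀ c m → suc c + (c + m) ≡ c + (c + suc m)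
    regroup = solve-∀

  sumTo-segments : ∀ H → sumTo n H ≡ sumTo c H + (sumTo m (λ t → H (c + t)) + sumTo (n ∸ b) (λ t → H (b + t)))
  sumTo-segments H = begin
      sumTo n H
        ≡⟨ sumTo-split-at hb H ⟩
      sumTo b H + sumTo (n ∸ b) (λ t → H (b + t))
        ≡⟨ cong (_+ sumTo (n ∸ b) (λ t → H (b + t))) (sumTo-split-at c≤b H) ⟩
      (sumTo c H + sumTo m (λ t → H (c + t))) + sumTo (n ∸ b) (λ t → H (b + t))
        ≡⟨ +-assoc (sumTo c H) _ _ ⟩
      sumTo c H + (sumTo m (λ t → H (c + t)) + sumTo (n ∸ b) (λ t → H (b + t))) ∎
    where open ≡-Reasoning

  sumTo-ρ : ∀ H → sumTo n H ≡ sumTo n (λ p → H (ρ p))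
  sumTo-ρ H = begin
      sumTo n H
        ≡⟨ sumTo-segments H ⟩
      sumTo c H + (sumTo m (λ t → H (c + t)) + sumTo (n ∸ b) (λ t → H (b + t)))
        ≡⟨ cong₂ (λ x y → x + (y + _)) on-before (sym (sumTo-reverse m (λ t → H (c + t)))) ⟩
      sumTo c H' + (sumTo m (λ t → H (c + (suc m ∸ t))) + sumTo (n ∸ b) (λ t → H (b + t)))
        ≡⟨ cong₂ (λ x y → sumTo c H' + (x + y)) on-inside on-after ⟩
      sumTo c H' + (sumTo m (λ t → H' (c + t)) + sumTo (n ∸ b) (λ t → H' (b + t)))
        ≡⟨ sym (sumTo-segments H') ⟩
      sumTo n H' ∎
    where
    open ≡-Reasoning
    H' = λ p → H (ρ p)
    on-before = sumTo-cong c (λ t _ h → cong H (sym (ρ-before (before-block h))))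
    on-inside = sumTo-cong m (λ t h1 h2 → cong H (sym (ρ-on-block h1 h2)))
    on-after  = sumTo-cong (n ∸ b) (λ t h _ → cong H (sym (ρ-after (after-block h))))

  sumTo-block : ∀ H → (∀ p → inBlock p ≡ false → H p ≡ 0) → sumTo n H ≡ sumTo m (λ t → H (c + t))
  sumTo-block H vanish = begin
      sumTo n H
        ≡⟨ sumTo-segments H ⟩
      sumTo c H + (sumTo m (λ t → H (c + t)) + sumTo (n ∸ b) (λ t → H (b + t)))
        ≡⟨ cong₂ (λ x y → x + (sumTo m (λ t → H (c + t)) + y)) on-before on-after ⟩
      0 + (sumTo m (λ t → H (c + t)) + 0)
        ≡⟨ +-identityʳ _ ⟩
      sumTo m (λ t → H (c + t)) ∎
    where
    open ≡-Reasoning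
    on-before = sumTo-zero c (λ t _ h → vanish t (inBlock-before (before-block h)))
    on-after  = sumTo-zero (n ∸ b) (λ t h _ → vanish (b + t) (inBlock-after (after-block h)))

  one-outside : ∀ {p q} (pp : Position a b p) (pq : Position a b q) → NotBothInside pp pq →
    inBlock p ≡ false ⊎ inBlock q ≡ false
  one-outside (before h)   _          _ = inj₁ (inBlock-before h)
  one-outside (after h)    _          _ = inj₁ (inBlock-after h)
  one-outside (inside _ _) (before h) _ = inj₂ (inBlock-before h)
  one-outside (inside _ _) (after h)  _ = inj₂ (inBlock-after h)

  blockPairSum : (ℕ → ℕ → ℕ) → ℕ
  blockPairSum W = pairSum n (λ p q → ind (inBlock p) * (ind (inBlock q) * W p q))

  blockPairSum-shift : ∀ W → blockPairSum W ≡ pairSum m (λ u v → W (c + u) (c + v))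
  blockPairSum-shift W = begin
      blockPairSum W
        ≡⟨ sumTo-block _ (λ p out → sumTo-zero n (λ q _ _ → first-out p q out)) ⟩
      sumTo m (λ u → sumTo n (λ q → if c + u <ᵇ q then blockTerm (c + u) q else 0))
        ≡⟨ sumTo-cong m (λ u _ _ → sumTo-block _ (λ q out → second-out (c + u) q out)) ⟩
      sumTo m (λ u → sumTo m (λ v → if c + u <ᵇ c + v then blockTerm (c + u) (c + v) else 0))
        ≡⟨ sumTo-cong m (λ u h1 h2 → sumTo-cong m (λ v h3 h4 → shifted u v h1 h2 h3 h4)) ⟩
      pairSum m (λ u v → W (c + u) (c + v)) ∎
    where
    open ≡-Reasoning
    blockTerm : ℕ → ℕ → ℕ
    blockTerm p q = ind (inBlock p) * (ind (inBlock q) * W p q)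
    first-out : ∀ p q → inBlock p ≡ false → (if p <ᵇ q then blockTerm p q else 0) ≡ 0
    first-out p q out rewrite out with p <ᵇ q
    ... | true  = refl
    ... | false = refl
    second-out : ∀ p q → inBlock q ≡ false → (if p <ᵇ q then blockTerm p q else 0) ≡ 0
    second-out p q out rewrite out | *-zeroʳ (ind (inBlock p)) with p <ᵇ q
    ... | true  = refl
    ... | false = refl
    shift-<ᵇ : ∀ u v → (c + u <ᵇ c + v) ≡ (u <ᵇ v)
    shift-<ᵇ u v with u <? v
    ... | yes h = trans (<ᵇ-true (+-monoʳ-< c h)) (sym (<ᵇ-true h))
    ... | no h  = trans (<ᵇ-false (λ h' → h (+-cancelˡ-< c u v h'))) (sym (<ᵇ-false h))
    shifted : ∀ u v → 1 ≤ u → u ≤ m → 1 ≤ v → v ≤ m →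
      (if c + u <ᵇ c + v then blockTerm (c + u) (c + v) else 0) ≡ (if u <ᵇ v then W (c + u) (c + v) else 0)
    shifted u v h1 h2 h3 h4 rewrite shift-<ᵇ u v | uncurry inBlock-inside (inside-block h1 h2)
                                  | uncurry inBlock-inside (inside-block h3 h4) with u <ᵇ v
    ... | true  = trans (+-identityʳ _) (+-identityʳ _)
    ... | false = refl

  -- Reversing the block of a map f that decreases on it: the inversions of f are
  -- those of f ∘ ρ plus all pairs inside the block, for any ρ-invariant weight W.
  module _ (f : ℕ → ℕ) (W : ℕ → ℕ → ℕ) (decreasing : ∀ p q → a ≤ p → p < q → q ≤ b → f q < f p) where

    private
      term : ℕ → ℕ → ℕ
      term p q = ind (f q <ᵇ f p) * W p q

      blockTerm : ℕ → ℕ → ℕ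
      blockTerm p q = ind (inBlock p) * (ind (inBlock q) * W p q)

      reflectedSum : ℕ
      reflectedSum = sumTo n (λ p → sumTo n (λ q → if ρ p <ᵇ ρ q then term p q else 0))

    -- pairs not both inside the block: ρ keeps their order and they are no block pairs
    split-outside : ∀ {p q} (pp : Position a b p) (pq : Position a b q) → NotBothInside pp pq →
      (if p <ᵇ q then term p q else 0) ≡ (if ρ p <ᵇ ρ q then term p q else 0) + (if p <ᵇ q then blockTerm p q else 0)
    split-outside {p} {q} pp pq nb rewrite ρ-preserves pp pq nb with p <ᵇ q | one-outside pp pq nb
    ... | false | _      = refl
    ... | true  | inj₁ e rewrite e = sym (+-identityʳ _)
    ... | true  | inj₂ e rewrite e | *-zeroʳ (ind (inBlock p)) = sym (+-identityʳ _)

    split-term : ∀ p q → (if p <ᵇ q then term p q else 0) ≡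
      (if ρ p <ᵇ ρ q then term p q else 0) + (if p <ᵇ q then blockTerm p q else 0)
    split-term p q with position a b p | position a b q
    ... | before h     | pq         = split-outside (before h) pq tt
    ... | after h      | pq         = split-outside (after h) pq tt
    ... | inside m1 m2 | before h   = split-outside (inside m1 m2) (before h) tt
    ... | inside m1 m2 | after h    = split-outside (inside m1 m2) (after h) tt
    ... | inside m1 m2 | inside m3 m4 with <-cmp p q
    ...   | tri< lt _ _ rewrite <ᵇ-true lt | <ᵇ-false (<⇒≯ (ρ-reverses m1 m4 lt)) | <ᵇ-true (decreasing p q m1 lt m4)
                              | inBlock-inside m1 m2 | inBlock-inside m3 m4 = sym (+-identityʳ (W p q + 0))
    ...   | tri≈ _ refl _ rewrite <ᵇ-false (n≮n p) | <ᵇ-false (n≮n (ρ p)) = refl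
    ...   | tri> _ _ gt rewrite <ᵇ-false (<⇒≯ gt) | <ᵇ-true (ρ-reverses m3 m2 gt)
                              | <ᵇ-false (<⇒≯ (decreasing q p m3 gt m2)) = refl

    invSum-split : invSum n f W ≡ reflectedSum + blockPairSum W
    invSum-split = begin
        invSum n f W
          ≡⟨ sumTo-cong n (λ p _ _ → sumTo-cong n (λ q _ _ → split-term p q)) ⟩
        sumTo n (λ p → sumTo n (λ q → (if ρ p <ᵇ ρ q then term p q else 0) + (if p <ᵇ q then blockTerm p q else 0)))
          ≡⟨ sumTo-cong n (λ p _ _ → sumTo-+ n _ _) ⟩
        sumTo n (λ p → sumTo n (λ q → if ρ p <ᵇ ρ q then term p q else 0) + sumTo n (λ q → if p <ᵇ q then blockTerm p q else 0))
          ≡⟨ sumTo-+ n _ _ ⟩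
        reflectedSum + blockPairSum W ∎
      where open ≡-Reasoning

    invSum-reflected : (g : ℕ → ℕ) → (∀ p q → W (ρ p) (ρ q) ≡ W p q) → (∀ p → 1 ≤ p → p ≤ n → g p ≡ f (ρ p)) →
      invSum n g W ≡ reflectedSum
    invSum-reflected g W-invariant g≡f∘ρ = begin
        invSum n g W
          ≡⟨ sumTo-cong n (λ p h1 h2 → sumTo-cong n (λ q h3 h4 → cong (if p <ᵇ q then_else 0)
               (cong₂ (λ x y → ind (x <ᵇ y) * W p q) (g≡f∘ρ q h3 h4) (g≡f∘ρ p h1 h2)))) ⟩
        sumTo n (λ p → sumTo n (λ q → if p <ᵇ q then ind (f (ρ q) <ᵇ f (ρ p)) * W p q else 0))
          ≡⟨ sumTo-ρ _ ⟩
        sumTo n (λ p → sumTo n (λ q → if ρ p <ᵇ q then ind (f (ρ q) <ᵇ f (ρ (ρ p))) * W (ρ p) q else 0))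
          ≡⟨ sumTo-cong n (λ p _ _ → sumTo-ρ _) ⟩
        sumTo n (λ p → sumTo n (λ q → if ρ p <ᵇ ρ q then ind (f (ρ (ρ q)) <ᵇ f (ρ (ρ p))) * W (ρ p) (ρ q) else 0))
          ≡⟨ sumTo-cong n (λ p _ _ → sumTo-cong n (λ q _ _ → cong (if ρ p <ᵇ ρ q then_else 0)
               (cong₂ _*_ (cong₂ (λ x y → ind (f x <ᵇ f y)) (ρ-involutive q) (ρ-involutive p)) (W-invariant p q)))) ⟩
        reflectedSum ∎
      where open ≡-Reasoning

    invSum-reverse : (g : ℕ → ℕ) → (∀ p q → W (ρ p) (ρ q) ≡ W p q) → (∀ p → 1 ≤ p → p ≤ n → g p ≡ f (ρ p)) →
      invSum n f W ≡ invSum n g W + blockPairSum W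
    invSum-reverse g W-invariant g≡f∘ρ =
      trans invSum-split (cong (_+ blockPairSum W) (sym (invSum-reflected g W-invariant g≡f∘ρ)))

pairSum-suc-suc : ∀ m X → pairSum (suc (suc m)) X ≡
  pairSum m X + sumTo m (λ u → X u (suc m)) + sumTo (suc m) (λ u → X u (suc (suc m)))
pairSum-suc-suc m X = trans (pairSum-suc (suc m) X) (cong (_+ sumTo (suc m) (λ u → X u (suc (suc m)))) (pairSum-suc m X))

-- all C(2k+1, 2) = k(2k+1) pairs
pairSum-ones : ∀ k → pairSum (suc (k + k)) (λ _ _ → 1) ≡ k + (k * k + k * k)
pairSum-ones zero    = refl
pairSum-ones (suc k) = begin
    pairSum (suc (suc k + suc k)) one
      ≡⟨ cong (λ w → pairSum (suc w) one) (+-suc (suc k) k) ⟩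
    pairSum (suc (suc (suc (k + k)))) one
      ≡⟨ pairSum-suc-suc (suc (k + k)) one ⟩
    pairSum (suc (k + k)) one + sumTo (suc (k + k)) (λ _ → 1) + sumTo (suc (suc (k + k))) (λ _ → 1)
      ≡⟨ cong₂ _+_ (cong₂ _+_ (pairSum-ones k) (sumTo-const _)) (sumTo-const _) ⟩
    k + (k * k + k * k) + suc (k + k) + suc (suc (k + k))
      ≡⟨ regroup k ⟩
    suc k + (suc k * suc k + suc k * suc k) ∎
  where
  open ≡-Reasoning
  one : ℕ → ℕ → ℕ
  one _ _ = 1
  regroup : ∀ k → k + (k * k + k * k) + suc (k + k) + suc (suc (k + k)) ≡ suc k + (suc k * suc k + suc k * suc k)
  regroup = solve-∀

odd-count : ∀ k → sumTo (k + k) (λ u → ind (not (even u))) ≡ k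
odd-count zero    = refl
odd-count (suc k) rewrite +-suc k k | odd-count k | even-double k = trans (+-identityʳ _) (+-comm k 1)

even-count : ∀ k → sumTo (k + k) (λ u → ind (even u)) ≡ k
even-count zero    = refl
even-count (suc k) rewrite +-suc k k | even-count k | even-double k = trans (cong (_+ 1) (+-identityʳ k)) (+-comm k 1)

pairSum-opposite : ∀ k → pairSum (suc (k + k)) oppositeParity ≡ k * suc k
pairSum-opposite zero    = refl
pairSum-opposite (suc k) = begin
    pairSum (suc (suc k + suc k)) oppositeParity
      ≡⟨ cong (λ w → pairSum (suc w) oppositeParity) (+-suc (suc k) k) ⟩
    pairSum (suc (suc (suc (k + k)))) oppositeParity
      ≡⟨ pairSum-suc-suc (suc (k + k)) oppositeParity ⟩
    pairSum (suc (k + k)) oppositeParity + sumTo (suc (k + k)) (λ u → oppositeParity u (suc (suc (k + k))))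
      + sumTo (suc (suc (k + k))) (λ u → oppositeParity u (suc (suc (suc (k + k)))))
      ≡⟨ cong₂ _+_ (cong₂ _+_ (pairSum-opposite k) against-even) against-odd ⟩
    k * suc k + suc k + suc k
      ≡⟨ regroup k ⟩
    suc k * suc (suc k) ∎
  where
  open ≡-Reasoning
  regroup : ∀ k → k * suc k + suc k + suc k ≡ suc k * suc (suc k)
  regroup = solve-∀
  -- the position 2k + 2 is even: it pairs with the k + 1 odd positions of [1, 2k+1]
  against-even : sumTo (suc (k + k)) (λ u → oppositeParity u (suc (suc (k + k)))) ≡ suc k
  against-even = begin
      sumTo (suc (k + k)) (λ u → oppositeParity u (suc (suc (k + k))))
        ≡⟨ sumTo-cong (suc (k + k)) (λ u _ _ → cong (λ e → ind (even u xor not (not e))) (even-double k)) ⟩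
      sumTo (suc (k + k)) (λ u → ind (even u xor true))
        ≡⟨ sumTo-cong (suc (k + k)) (λ u _ _ → cong ind (xor-true (even u))) ⟩
      sumTo (k + k) (λ u → ind (not (even u))) + ind (not (not (even (k + k))))
        ≡⟨ cong₂ (λ x e → x + ind (not (not e))) (odd-count k) (even-double k) ⟩
      k + 1
        ≡⟨ +-comm k 1 ⟩
      suc k ∎
    where
    xor-true : ∀ x → x xor true ≡ not x
    xor-true true  = refl
    xor-true false = refl
  -- the position 2k + 3 is odd: it pairs with the k + 1 even positions of [1, 2k+2]
  against-odd : sumTo (suc (suc (k + k))) (λ u → oppositeParity u (suc (suc (suc (k + k))))) ≡ suc k
  against-odd = begin
      sumTo (suc (suc (k + k))) (λ u → oppositeParity u (suc (suc (suc (k + k)))))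
        ≡⟨ sumTo-cong (suc (suc (k + k))) (λ u _ _ →
             trans (cong (λ e → ind (even u xor not (not (not e)))) (even-double k)) (cong ind (xor-identityʳ (even u)))) ⟩
      sumTo (suc (suc (k + k))) (λ u → ind (even u))
        ≡⟨ cong (λ w → sumTo w (λ u → ind (even u))) (sym (+-suc (suc k) k)) ⟩
      sumTo (suc k + suc k) (λ u → ind (even u))
        ≡⟨ even-count (suc k) ⟩
      suc k ∎

oppositeParity-shift : ∀ c u v → oppositeParity (c + u) (c + v) ≡ oppositeParity u v
oppositeParity-shift c u v = cong ind (trans (cong₂ _xor_ (even-+ c u) (even-+ c v)) (cancel (even c) (even u) (even v)))
  where
  cancel : ∀ e x y → not (e xor x) xor not (e xor y) ≡ x xor y
  cancel true  x y rewrite not-involutive x | not-involutive y = refl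
  cancel false true  y = refl
  cancel false false y = not-involutive y

InjectiveOn : ℕ → (ℕ → ℕ) → Set
InjectiveOn n f = ∀ p q → 1 ≤ p → p < q → q ≤ n → f p ≢ f q

injective-distinct : ∀ {n f x y} → InjectiveOn n f → 1 ≤ x × x ≤ n → 1 ≤ y × y ≤ n → x ≢ y → f x ≢ f y
injective-distinct {x = x} {y} inj (x1 , xn) (y1 , yn) x≢y with <-cmp x y
... | tri< lt _ _ = inj x y x1 lt yn
... | tri≈ _ eq _ = ⊥-elim (x≢y eq)
... | tri> _ _ gt = λ e → inj y x y1 gt xn (sym e)

isPerm⇒injective : ∀ {n} (σ : Vec (Fin n) n) → isPerm σ ≡ true → InjectiveOn n (val σ)
isPerm⇒injective σ perm p q h1 h2 h3 e = ⊥-elim (distinct-false (all-∈ _ perm (pairs-∈⁺ h1 h2 h3)))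
  where
  distinct-false : not (val σ p ≡ᵇ val σ q) ≢ true
  distinct-false d = subst (λ z → not z ≢ true) (sym (dec-true (val σ p ≟ val σ q) e)) (λ ()) d

injective⇒isPerm : ∀ {n} (σ : Vec (Fin n) n) → InjectiveOn n (val σ) → isPerm σ ≡ true
injective⇒isPerm {n} σ inj = all-intro _ (pairs n) λ { (p , q) mem →
  let (h1 , h2 , h3) = pairs-∈⁻ mem in cong not (dec-false (val σ p ≟ val σ q) (inj p q h1 h2 h3)) }

descending-chain : ∀ {a b} (f : ℕ → ℕ) → (∀ m → a ≤ m → suc m ≤ b → f (suc m) < f m) →
  ∀ p q → a ≤ p → p < q → q ≤ b → f q < f p
descending-chain f step p (suc q) h1 (s≤s p≤q) h3 with m≤n⇒m<n∨m≡n p≤q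
... | inj₁ p<q = <-trans (step q (≤-trans h1 p≤q) h3) (descending-chain f step p q h1 p<q (≤-trans (n≤1+n q) h3))
... | inj₂ refl = step p h1 h3

descent : (ℕ → ℕ) → ℕ → Bool
descent f m = f (suc m) <ᵇ f m

admissible : Subset → Subset → (ℕ → ℕ) → ℕ → Bool
admissible I J f m = (not (J m) ∨ descent f m) ∧ (not (I m) ∨ not (descent f m))

admissibleAll : ℕ → Subset → Subset → (ℕ → ℕ) → Bool
admissibleAll n I J f = all (admissible I J f) (range 1 (n ∸ 1))

admissible-free : ∀ {I J m} f → (I ∪ J) m ≡ false → admissible I J f m ≡ true
admissible-free {I} {J} {m} f free with I m | J m | free
... | false | false | _ = refl

admissible-J : ∀ {I J m} f → J m ≡ true → I m ≡ false → admissible I J f m ≡ descent f m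
admissible-J {I} {J} {m} f j i rewrite j | i with descent f m
... | true  = refl
... | false = refl

admissible-moved : ∀ {I J K m} g → K m ≡ true → admissible (I ∪ K) (J ∖ K) g m ≡ not (descent g m)
admissible-moved {I} {J} {K} {m} g e rewrite e | ∨-zeroʳ (I m) | ∧-zeroʳ (J m) = refl

admissible-unmoved : ∀ {I J K m} g → K m ≡ false → admissible (I ∪ K) (J ∖ K) g m ≡ admissible I J g m
admissible-unmoved {I} {J} {K} {m} g e rewrite e | ∨-identityʳ (I m) | ∧-identityʳ (J m) = refl

bool-⇔ : ∀ {x y : Bool} → (x ≡ true → y ≡ true) → (y ≡ true → x ≡ true) → x ≡ y
bool-⇔ {true}          f g = sym (f refl)
bool-⇔ {false} {false} f g = refl
bool-⇔ {false} {true}  f g = g refl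

if-scale : ∀ (c : ℤ) {x y : Bool} {u v : ℤ} → x ≡ y → (x ≡ true → u ≡ c *ℤ v) →
  (if x then u else 0ℤ) ≡ c *ℤ (if y then v else 0ℤ)
if-scale c {false} refl _ = sym (ℤ.*-zeroʳ c)
if-scale c {true}  refl e = e refl

sign-double : ∀ j → -1ℤ ^ℤ (j + j) ≡ 1ℤ
sign-double zero    = refl
sign-double (suc j) rewrite +-suc j j = cong (λ z → -1ℤ *ℤ (-1ℤ *ℤ z)) (sign-double j)

module Component (n : ℕ) (I J : Subset) (disjoint : Disjoint I J) (a k : ℕ) (ha : 1 ≤ a)
  (b≤n : a + 2 * k ≤ n) (K⊆J : interval a (a + 2 * k ∸ 1) ⊆ J)
  (left-free : (I ∪ J) (a ∸ 1) ≡ false) (right-free : (I ∪ J) (suc (a + 2 * k ∸ 1)) ≡ false) where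

  b : ℕ
  b = a + 2 * k

  K : Subset
  K = interval a (b ∸ 1)

  a≤b : a ≤ b
  a≤b = m≤m+n a (2 * k)

  suc-b∸1 : suc (b ∸ 1) ≡ b
  suc-b∸1 = suc∸1 (≤-trans ha a≤b)

  -- a + b = 2(a + k) is even, so ρ preserves parity
  a+b-even : even (a + b) ≡ true
  a+b-even = trans (cong even (regroup a k)) (even-double (a + k))
    where
    regroup : ∀ a k → a + (a + 2 * k) ≡ (a + k) + (a + k)
    regroup = solve-∀

  open Reflection a b
  open WordReversal n a b ha b≤n
  open BlockSums n a b ha a≤b b≤n

  block-length : m ≡ suc (k + k)
  block-length = trans (cong (_∸ (a ∸ 1)) (trans (cong (_+ 2 * k) (sym (suc∸1 ha))) (regroup (a ∸ 1) k)))
                       (m+n∸m≡n (a ∸ 1) (suc (k + k)))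
    where
    regroup : ∀ c k → suc c + 2 * k ≡ c + suc (k + k)
    regroup = solve-∀

  Word : Set
  Word = Vec (Fin n) n

  Reflected : (ℕ → ℕ) → (ℕ → ℕ) → Set
  Reflected f g = ∀ p → 1 ≤ p → p ≤ n → g p ≡ f (ρ p)

  injective-reflected : ∀ {f g} → Reflected f g → InjectiveOn n f → InjectiveOn n g
  injective-reflected {f} R inj p q h1 h2 h3 e =
    injective-distinct inj (ρ-bounds ha b≤n h1 p≤n) (ρ-bounds ha b≤n 1≤q h3) (λ eq → <-irrefl (ρ-injective eq) h2)
      (trans (sym (R p h1 p≤n)) (trans e (R q 1≤q h3)))
    where
    p≤n = ≤-trans (<⇒≤ h2) h3
    1≤q = ≤-trans h1 (<⇒≤ h2)

  perm-reversed : ∀ σ → isPerm σ ≡ true → isPerm (reverse-block σ) ≡ true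
  perm-reversed σ perm = injective⇒isPerm (reverse-block σ) (injective-reflected (val-reverse-block σ) (isPerm⇒injective σ perm))

  parity-reflected : ∀ σ p → 1 ≤ p → p ≤ n → even (p + val (reverse-block σ) p) ≡ even (ρ p + val σ (ρ p))
  parity-reflected σ p h1 h2 = begin
      even (p + val (reverse-block σ) p)     ≡⟨ cong (λ z → even (p + z)) (val-reverse-block σ p h1 h2) ⟩
      even (p + val σ (ρ p))                 ≡⟨ even-+ p _ ⟩
      not (even p xor even (val σ (ρ p)))    ≡⟨ cong (λ z → not (z xor even (val σ (ρ p)))) (sym (ρ-even a+b-even p)) ⟩
      not (even (ρ p) xor even (val σ (ρ p))) ≡⟨ sym (even-+ (ρ p) _) ⟩
      even (ρ p + val σ (ρ p))               ∎
    where open ≡-Reasoning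

  class-reversed : ∀ s σ → parityOK s σ ≡ true → parityOK s (reverse-block σ) ≡ true
  class-reversed Sign.+ σ ok = all-intro _ (range 1 n) λ p mem →
    let (h1 , h2) = range-∈⁻ mem ; (b1 , b2) = ρ-bounds ha b≤n h1 h2
    in trans (parity-reflected σ p h1 h2) (all-∈ _ ok (range-∈⁺ b1 b2))
  class-reversed Sign.- σ ok = all-intro _ (range 1 n) λ p mem →
    let (h1 , h2) = range-∈⁻ mem ; (b1 , b2) = ρ-bounds ha b≤n h1 h2
    in trans (cong not (parity-reflected σ p h1 h2)) (all-∈ _ ok (range-∈⁺ b1 b2))

  K-member : ∀ {m} → a ≤ m → suc m ≤ b → K m ≡ true
  K-member {m} h1 h2 = cong₂ _∧_ (≤ᵇ-true h1) (≤ᵇ-true (s≤s⁻¹ (subst (suc m ≤_) (sym suc-b∸1) h2)))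

  K-bounds : ∀ {m} → K m ≡ true → a ≤ m × suc m ≤ b
  K-bounds {m} e with a ≤ᵇ m in e1 | m ≤ᵇ b ∸ 1 in e2 | e
  ... | true | true | _ = ≤ᵇ⇒≤ a m (≡true⇒T e1) , subst (suc m ≤_) suc-b∸1 (s≤s (≤ᵇ⇒≤ m (b ∸ 1) (≡true⇒T e2)))

  K-outside : ∀ {m} → K m ≡ false → m < a ⊎ b ≤ m
  K-outside {m} e with m <? a | b ≤? m
  ... | yes h | _     = inj₁ h
  ... | _     | yes h = inj₂ h
  ... | no h  | no h' with () ← trans (sym (K-member (≮⇒≥ h) (≰⇒> h'))) e

  K-in-range : ∀ {m} → K m ≡ true → m ∈ range 1 (n ∸ 1)
  K-in-range e with K-bounds e
  ... | h1 , h2 = range-∈⁺ (≤-trans ha h1) (s≤s⁻¹ (subst (_ ≤_) (sym (suc∸1 (≤-trans ha (≤-trans a≤b b≤n)))) (≤-trans h2 b≤n)))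

  descent-fixed : ∀ {f g m} → Reflected f g → 1 ≤ m → suc m ≤ n → ρ m ≡ m → ρ (suc m) ≡ suc m →
    descent f m ≡ descent g m
  descent-fixed {f} R h1 h2 e1 e2 =
    sym (cong₂ _<ᵇ_ (trans (R _ (s≤s z≤n) h2) (cong f e2)) (trans (R _ h1 (≤-trans (n≤1+n _) h2)) (cong f e1)))

  admissible-outside : ∀ {f g m} → Reflected f g → 1 ≤ m → m ≤ n ∸ 1 → K m ≡ false →
    admissible I J f m ≡ admissible (I ∪ K) (J ∖ K) g m
  admissible-outside {f} {g} {m} R h1 h2 e = trans (by-position (K-outside e)) (sym (admissible-unmoved {I} {J} {K} g e))
    where
    sm≤n : suc m ≤ n
    sm≤n = subst (suc m ≤_) (suc∸1 (≤-trans ha (≤-trans a≤b b≤n))) (s≤s h2)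
    unchanged : ρ m ≡ m → ρ (suc m) ≡ suc m → admissible I J f m ≡ admissible I J g m
    unchanged e1 e2 = cong (λ d → (not (J m) ∨ d) ∧ (not (I m) ∨ not d)) (descent-fixed {f} {g} R h1 sm≤n e1 e2)
    free : (I ∪ J) m ≡ false → admissible I J f m ≡ admissible I J g m
    free e = trans (admissible-free {I} {J} f e) (sym (admissible-free {I} {J} g e))
    by-position : m < a ⊎ b ≤ m → admissible I J f m ≡ admissible I J g m
    by-position (inj₁ lt) with <-cmp (suc m) a
    ... | tri< l _ _    = unchanged (ρ-before lt) (ρ-before l)
    ... | tri≈ _ refl _ = free left-free
    ... | tri> _ _ gt   = ⊥-elim (<⇒≱ lt (s≤s⁻¹ gt))
    by-position (inj₂ le) with <-cmp b m
    ... | tri< l _ _    = unchanged (ρ-after l) (ρ-after (m<n⇒m<1+n l))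
    ... | tri≈ _ refl _ = free (subst (λ z → (I ∪ J) z ≡ false) suc-b∸1 right-free)
    ... | tri> _ _ gt   = ⊥-elim (<⇒≱ gt le)

  -- inside K, the descent of g = f ∘ ρ at the mirror position ρ (m + 1) is an ascent of f at m
  mirror : ℕ → ℕ
  mirror m = ρ (suc m)

  module _ {m : ℕ} (e : K m ≡ true) where
    private
      am = proj₁ (K-bounds e)
      smb = proj₂ (K-bounds e)
      m-in = ρ-inside-bounds am (≤-trans (n≤1+n m) smb)
      sm-in = ρ-inside-bounds (≤-trans am (n≤1+n m)) smb

    suc-mirror : suc (mirror m) ≡ ρ m
    suc-mirror = begin
        suc (ρ (suc m))        ≡⟨ cong suc (ρ-inside (≤-trans am (n≤1+n m)) smb) ⟩
        suc (a + b ∸ suc m)    ≡⟨ sym (+-∸-assoc 1 (≤-trans smb (m≤n+m b a))) ⟩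
        a + b ∸ m              ≡⟨ sym (ρ-inside am (≤-trans (n≤1+n m) smb)) ⟩
        ρ m                    ∎
      where open ≡-Reasoning

    mirror-in-K : K (mirror m) ≡ true
    mirror-in-K = K-member (proj₁ sm-in) (subst (_≤ b) (sym suc-mirror) (proj₂ m-in))

    mirror-involutive : mirror (mirror m) ≡ m
    mirror-involutive = trans (cong ρ suc-mirror) (ρ-involutive m)

    descent-mirror : ∀ {f g} → Reflected f g → descent g (mirror m) ≡ (f m <ᵇ f (suc m))
    descent-mirror {f} {g} R = cong₂ _<ᵇ_
      (trans (cong g suc-mirror) (trans (R (ρ m) (≤-trans ha (proj₁ m-in)) (≤-trans (proj₂ m-in) b≤n)) (cong f (ρ-involutive m))))
      (trans (R (mirror m) (≤-trans ha (proj₁ sm-in)) (≤-trans (proj₂ sm-in) b≤n)) (cong f (ρ-involutive (suc m))))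

  I-outside-J : ∀ {m} → J m ≡ true → I m ≡ false
  I-outside-J {m} j with I m | disjoint m
  ... | false | _ = refl
  ... | true  | d rewrite j with () ← d

  admissible-K : ∀ {f m} → K m ≡ true → admissible I J f m ≡ descent f m
  admissible-K {f} {m} e = admissible-J {I} {J} f (K⊆J m e) (I-outside-J (K⊆J m e))

  -- σ ∈ 𝒟^I_J iff σ ∘ ρ ∈ 𝒟^{I∪K}_{J∖K}, for σ injective: compare outside K
  -- position by position, and inside K each descent of f with an ascent of g
  -- at the mirror position
  admissible-reversed : ∀ {f g} → Reflected f g → InjectiveOn n f →
    admissibleAll n I J f ≡ admissibleAll n (I ∪ K) (J ∖ K) g
  admissible-reversed {f} {g} R inj = bool-⇔ forward backward
    where
    forward : admissibleAll n I J f ≡ true → admissibleAll n (I ∪ K) (J ∖ K) g ≡ true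
    forward all-f = all-intro _ _ λ m mem → at m mem (K m) refl
      where
      at : ∀ m → m ∈ range 1 (n ∸ 1) → ∀ x → K m ≡ x → admissible (I ∪ K) (J ∖ K) g m ≡ true
      at m mem false e = trans (sym (admissible-outside {f} {g} R (proj₁ (range-∈⁻ mem)) (proj₂ (range-∈⁻ mem)) e)) (all-∈ _ all-f mem)
      at m mem true  e = trans (admissible-moved {I} {J} {K} g e) (cong not no-ascent)
        where
        m' = mirror m
        e' = mirror-in-K e
        f-descends : f (suc m') < f m'
        f-descends = <ᵇ⇒< _ _ (≡true⇒T (trans (sym (admissible-K {f} e')) (all-∈ _ all-f (K-in-range e'))))
        no-ascent : descent g m ≡ false
        no-ascent = trans (cong (descent g) (sym (mirror-involutive e))) (trans (descent-mirror e' {f} {g} R) (<ᵇ-false (<⇒≯ f-descends)))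
    backward : admissibleAll n (I ∪ K) (J ∖ K) g ≡ true → admissibleAll n I J f ≡ true
    backward all-g = all-intro _ _ λ m mem → at m mem (K m) refl
      where
      at : ∀ m → m ∈ range 1 (n ∸ 1) → ∀ x → K m ≡ x → admissible I J f m ≡ true
      at m mem false e = trans (admissible-outside {f} {g} R (proj₁ (range-∈⁻ mem)) (proj₂ (range-∈⁻ mem)) e) (all-∈ _ all-g mem)
      at m mem true  e = trans (admissible-K {f} e) (<ᵇ-true (≤∧≢⇒< (≮⇒≥ no-ascent) (≢-sym distinct)))
        where
        e' = mirror-in-K e
        no-ascent : ¬ f m < f (suc m)
        no-ascent lt with () ← subst (λ d → not d ≡ true) (trans (descent-mirror e {f} {g} R) (<ᵇ-true lt))
                                 (trans (sym (admissible-moved {I} {J} {K} g e')) (all-∈ _ all-g (K-in-range e')))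
        distinct : f m ≢ f (suc m)
        distinct = inj m (suc m) (proj₁ (range-∈⁻ mem)) ≤-refl (≤-trans (proj₂ (K-bounds e)) b≤n)

  block-decreasing : ∀ {f} → admissibleAll n I J f ≡ true → ∀ p q → a ≤ p → p < q → q ≤ b → f q < f p
  block-decreasing {f} all-f = descending-chain f λ m h1 h2 →
    <ᵇ⇒< _ _ (≡true⇒T (trans (sym (admissible-K {f} (K-member h1 h2))) (all-∈ _ all-f (K-in-range (K-member h1 h2)))))

  block-ones : blockPairSum (λ _ _ → 1) ≡ k + (k * k + k * k)
  block-ones = trans (blockPairSum-shift _) (trans (cong (λ z → pairSum z (λ _ _ → 1)) block-length) (pairSum-ones k))

  block-opposite : blockPairSum oppositeParity ≡ k * suc k
  block-opposite = begin
      blockPairSum oppositeParity                         ≡⟨ blockPairSum-shift _ ⟩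
      pairSum m (λ u v → oppositeParity (c + u) (c + v))  ≡⟨ pairSum-cong m (λ u v _ _ _ → oppositeParity-shift c u v) ⟩
      pairSum m oppositeParity                            ≡⟨ cong (λ z → pairSum z oppositeParity) block-length ⟩
      pairSum (suc (k + k)) oppositeParity                ≡⟨ pairSum-opposite k ⟩
      k * suc k                                           ∎
    where open ≡-Reasoning

  module _ (σ : Word) (adm : admissibleAll n I J (val σ) ≡ true) where

    ℓ-reversed : ℓ σ ≡ ℓ (reverse-block σ) + (k + (k * k + k * k))
    ℓ-reversed = begin
        ℓ σ                                              ≡⟨ ℓ-invSum σ ⟩
        invSum n (val σ) (λ _ _ → 1)                     ≡⟨ invSum-reverse (val σ) _ (block-decreasing adm) _ (λ _ _ → refl) (val-reverse-block σ) ⟩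
        invSum n (val (reverse-block σ)) (λ _ _ → 1) + blockPairSum (λ _ _ → 1)
          ≡⟨ cong₂ _+_ (sym (ℓ-invSum (reverse-block σ))) block-ones ⟩
        ℓ (reverse-block σ) + (k + (k * k + k * k))      ∎
      where open ≡-Reasoning

    L-reversed : L σ ≡ L (reverse-block σ) + k * suc k
    L-reversed = begin
        L σ                                              ≡⟨ L-invSum σ ⟩
        invSum n (val σ) oppositeParity                  ≡⟨ invSum-reverse (val σ) _ (block-decreasing adm) _ parity-invariant (val-reverse-block σ) ⟩
        invSum n (val (reverse-block σ)) oppositeParity + blockPairSum oppositeParity
          ≡⟨ cong₂ _+_ (sym (L-invSum (reverse-block σ))) block-opposite ⟩
        L (reverse-block σ) + k * suc k                  ∎
      where
      open ≡-Reasoning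
      parity-invariant : ∀ p q → oppositeParity (ρ p) (ρ q) ≡ oppositeParity p q
      parity-invariant p q = cong₂ (λ x y → ind (x xor y)) (ρ-even a+b-even p) (ρ-even a+b-even q)

  weight : ℤ → Word → ℤ
  weight x σ = (-1ℤ ^ℤ ℓ σ) *ℤ (x ^ℤ L σ)

  factor : ℤ → ℤ
  factor x = (-1ℤ ^ℤ k) *ℤ (x ^ℤ (k * suc k))

  weight-reversed : ∀ x σ → admissibleAll n I J (val σ) ≡ true → weight x σ ≡ factor x *ℤ weight x (reverse-block σ)
  weight-reversed x σ adm = begin
      (-1ℤ ^ℤ ℓ σ) *ℤ (x ^ℤ L σ)
        ≡⟨ cong₂ (λ u v → (-1ℤ ^ℤ u) *ℤ (x ^ℤ v)) (ℓ-reversed σ adm) (L-reversed σ adm) ⟩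
      (-1ℤ ^ℤ (ℓ τ + (k + (k * k + k * k)))) *ℤ (x ^ℤ (L τ + k * suc k))
        ≡⟨ cong₂ _*ℤ_ (trans (ℤ.^-distribˡ-+-* -1ℤ (ℓ τ) _) (cong ((-1ℤ ^ℤ ℓ τ) *ℤ_) (ℤ.^-distribˡ-+-* -1ℤ k _)))
                      (ℤ.^-distribˡ-+-* x (L τ) _) ⟩
      ((-1ℤ ^ℤ ℓ τ) *ℤ ((-1ℤ ^ℤ k) *ℤ (-1ℤ ^ℤ (k * k + k * k)))) *ℤ ((x ^ℤ L τ) *ℤ (x ^ℤ (k * suc k)))
        ≡⟨ cong (λ z → ((-1ℤ ^ℤ ℓ τ) *ℤ ((-1ℤ ^ℤ k) *ℤ z)) *ℤ ((x ^ℤ L τ) *ℤ (x ^ℤ (k * suc k)))) (sign-double (k * k)) ⟩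
      ((-1ℤ ^ℤ ℓ τ) *ℤ ((-1ℤ ^ℤ k) *ℤ 1ℤ)) *ℤ ((x ^ℤ L τ) *ℤ (x ^ℤ (k * suc k)))
        ≡⟨ regroup (-1ℤ ^ℤ ℓ τ) (-1ℤ ^ℤ k) (x ^ℤ L τ) (x ^ℤ (k * suc k)) ⟩
      factor x *ℤ weight x τ ∎
    where
    open ≡-Reasoning
    τ = reverse-block σ
    regroup : ∀ (s t u v : ℤ) → (s *ℤ (t *ℤ 1ℤ)) *ℤ (u *ℤ v) ≡ (t *ℤ v) *ℤ (s *ℤ u)
    regroup = ℤ-Solver.solve-∀

  -- the summand of genSum over 𝒟_·(X) for X ⊆ S_n cut out by Q, as a function on all words
  restricted : ℤ → (Word → Bool) → Subset → Subset → Word → ℤ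
  restricted x Q I' J' σ =
    if isPerm σ then (if Q σ then (if admissibleAll n I' J' (val σ) then weight x σ else 0ℤ) else 0ℤ) else 0ℤ

  perm-≡ : ∀ σ → isPerm σ ≡ isPerm (reverse-block σ)
  perm-≡ σ = bool-⇔ (perm-reversed σ) (λ e → subst (λ τ → isPerm τ ≡ true) (reverse-block-involutive σ) (perm-reversed (reverse-block σ) e))

  reversal-sum : ∀ x (Q : Word → Bool) → (∀ σ → isPerm σ ≡ true → Q σ ≡ true → Q (reverse-block σ) ≡ true) →
    sumℤ (allVecs n n) (restricted x Q I J) ≡ factor x *ℤ sumℤ (allVecs n n) (restricted x Q (I ∪ K) (J ∖ K))
  reversal-sum x Q Q-stable =
    sum-involution n n reverse-block reverse-block-involutive (factor x) (restricted x Q I J) (restricted x Q (I ∪ K) (J ∖ K)) λ σ →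
    if-scale (factor x) (perm-≡ σ) λ perm →
    if-scale (factor x) (Q-≡ σ perm) λ _ →
    if-scale (factor x) (admissible-reversed (val-reverse-block σ) (isPerm⇒injective σ perm)) λ adm →
    weight-reversed x σ adm
    where
    Q-≡ : ∀ σ → isPerm σ ≡ true → Q σ ≡ Q (reverse-block σ)
    Q-≡ σ perm = bool-⇔ (Q-stable σ perm) λ e →
      subst (λ τ → Q τ ≡ true) (reverse-block-involutive σ) (Q-stable (reverse-block σ) (perm-reversed σ perm) e)

  unfold-C : ∀ I' J' s x → genSum x (𝒟 n I' J' (C n s)) ≡ sumℤ (allVecs n n) (restricted x (parityOK s) I' J')
  unfold-C I' J' s x =
    trans (sumℤ-filter _ (C n s) (weight x)) (trans (sumℤ-filter _ (Sym n) _) (sumℤ-filter _ (allVecs n n) _))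

  unfold-Sym : ∀ I' J' x → genSum x (𝒟 n I' J' (Sym n)) ≡ sumℤ (allVecs n n) (restricted x (λ _ → true) I' J')
  unfold-Sym I' J' x = trans (sumℤ-filter _ (Sym n) (weight x)) (sumℤ-filter _ (allVecs n n) _)

  C-identity : ∀ s x → genSum x (𝒟 n I J (C n s)) ≡ factor x *ℤ genSum x (𝒟 n (I ∪ K) (J ∖ K) (C n s))
  C-identity s x = begin
      genSum x (𝒟 n I J (C n s))                                           ≡⟨ unfold-C I J s x ⟩
      sumℤ (allVecs n n) (restricted x (parityOK s) I J)                   ≡⟨ reversal-sum x (parityOK s) (λ σ _ → class-reversed s σ) ⟩
      factor x *ℤ sumℤ (allVecs n n) (restricted x (parityOK s) (I ∪ K) (J ∖ K)) ≡⟨ cong (factor x *ℤ_) (sym (unfold-C (I ∪ K) (J ∖ K) s x)) ⟩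
      factor x *ℤ genSum x (𝒟 n (I ∪ K) (J ∖ K) (C n s))                  ∎
    where open ≡-Reasoning

  Sym-identity : ∀ x → genSum x (𝒟 n I J (Sym n)) ≡ factor x *ℤ genSum x (𝒟 n (I ∪ K) (J ∖ K) (Sym n))
  Sym-identity x = begin
      genSum x (𝒟 n I J (Sym n))                                           ≡⟨ unfold-Sym I J x ⟩
      sumℤ (allVecs n n) (restricted x (λ _ → true) I J)                   ≡⟨ reversal-sum x (λ _ → true) (λ _ _ _ → refl) ⟩
      factor x *ℤ sumℤ (allVecs n n) (restricted x (λ _ → true) (I ∪ K) (J ∖ K)) ≡⟨ cong (factor x *ℤ_) (sym (unfold-Sym (I ∪ K) (J ∖ K) x)) ⟩
      factor x *ℤ genSum x (𝒟 n (I ∪ K) (J ∖ K) (Sym n))                  ∎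
    where open ≡-Reasoning

block-within : ∀ n (J : Subset) i k → 1 ≤ n → 1 ≤ k → ⊆[ n -1] J → interval i (i + 2 * k ∸ 1) ⊆ J → i + 2 * k ≤ n
block-within n J i k hn hk J⊆ K⊆J = subst₂ _≤_ (suc∸1 1≤b) (suc∸1 hn) (s≤s (proj₂ (J⊆ (b ∸ 1) (K⊆J (b ∸ 1) last∈K))))
  where
  b = i + 2 * k
  1≤b : 1 ≤ b
  1≤b = ≤-trans hk (≤-trans (m≤m+n k (k + 0)) (m≤n+m (2 * k) i))
  last∈K : interval i (b ∸ 1) (b ∸ 1) ≡ true
  last∈K = cong₂ _∧_ (≤ᵇ-true (s≤s⁻¹ (subst₂ _≤_ (+-comm i 1) (sym (suc∸1 1≤b)) (+-monoʳ-≤ i (≤-trans hk (m≤m+n k (k + 0)))))))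
                     (≤ᵇ-true (≤-refl {b ∸ 1}))

lemma3p6 : (n : ℕ) → 1 ≤ n → (I J : Subset) → ⊆[ n -1] I → ⊆[ n -1] J → Disjoint I J →
    (i k : ℕ) → 1 ≤ i → 1 ≤ k →
    IsComponent i (i + 2 * k ∸ 1) (I ∪ J) → interval i (i + 2 * k ∸ 1) ⊆ J →
    ((s : Sign) → (x : ℤ) →
      genSum x (𝒟 n I J (C n s))
        ≡ ((-1ℤ ^ℤ k) *ℤ (x ^ℤ (k * suc k)))
          *ℤ genSum x (𝒟 n (I ∪ interval i (i + 2 * k ∸ 1)) (J ∖ interval i (i + 2 * k ∸ 1)) (C n s)))
    × ((x : ℤ) →
      genSum x (𝒟 n I J (Sym n))
        ≡ ((-1ℤ ^ℤ k) *ℤ (x ^ℤ (k * suc k)))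
          *ℤ genSum x (𝒟 n (I ∪ interval i (i + 2 * k ∸ 1)) (J ∖ interval i (i + 2 * k ∸ 1)) (Sym n)))
lemma3p6 n hn I J _ J⊆ disjoint i k hi hk (_ , left-free , right-free) K⊆J = C-identity , Sym-identity
  where open Component n I J disjoint i k hi (block-within n J i k hn hk J⊆ K⊆J) K⊆J left-free right-free
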